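{- Let $G=P_{n_1}\Box P_{n_2}\Box\cdots\Box P_{n_k}$, where $P_{n_i}$ is a path with $n_i$ vertices ($1\leq i\leq k$). Then $$rx_3(G)=\sum_{i=1}^{k} n_i-k.$$
   Context: In an edge-colored graph (adjacent edges may share colors), a tree is a rainbow tree if no two of its edges have the same color. An edge coloring of $G$ is a $3$-rainbow coloring if for every set $S$ of $3$ vertices there is a rainbow tree in $G$ containing $S$; $rx_3(G)$ is the minimum number of colors in a $3$-rainbow coloring of $G$. The Cartesian product $G\Box H$ has vertex set $V(G)\times V(H)$, with $(g_1,h_1)$ and $(g_2,h_2)$ adjacent iff either $g_1=g_2$ and $h_1h_2\in E(H)$, or $h_1=h_2$ and $g_1g_2\in E(G)$. -}

module Defs where

open import Data.Nat using (ℕ; zero; suc; _+_; _*_; _∸_; _≤_)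
open import Data.Fin using (Fin; toℕ)
open import Data.Unit using (⊤)
open import Data.Empty using (⊥)
open import Data.Product using (Σ; _×_; _,_; proj₁; proj₂)
open import Data.Sum using (_⊎_)
open import Data.List using (List; []; _∷_; length)
open import Data.List.Relation.Unary.All using (All)
open import Data.List.Relation.Unary.Any using (Any)
open import Data.List.Relation.Unary.AllPairs using (AllPairs)
open import Data.List.Relation.Unary.Unique.Propositional using (Unique)
open import Data.List.Membership.Propositional using (_∈_)
open import Data.Vec using (Vec; []; _∷_)
open import Relation.Binary.PropositionalEquality using (_≡_; _≢_)
open import Relation.Nullary using (¬_)

record Graph : Set₁ where
  field
    V   : Set
    Adj : V → V → Set
open Graph public

Path : ℕ → Graph
Path n = record
  { V = Fin n
  ; Adj = λ a b → (suc (toℕ a) ≡ toℕ b) ⊎ (suc (toℕ b) ≡ toℕ a) }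

K1 : Graph
K1 = record { V = ⊤ ; Adj = λ _ _ → ⊥ }

_□_ : Graph → Graph → Graph
G □ H = record
  { V = V G × V H
  ; Adj = λ x y →
      (proj₁ x ≡ proj₁ y × Adj H (proj₂ x) (proj₂ y))
      ⊎ (proj₂ x ≡ proj₂ y × Adj G (proj₁ x) (proj₁ y)) }

ProdPaths : ∀ {k} → Vec ℕ k → Graph
ProdPaths [] = K1
ProdPaths (n ∷ []) = Path n
ProdPaths (n ∷ m ∷ ns) = Path n □ ProdPaths (m ∷ ns)

productV : ∀ {k} → Vec ℕ k → ℕ
productV [] = 1
productV (n ∷ ns) = n * productV ns

module _ (G : Graph) where

  Edge : Set
  Edge = Σ (V G) λ u → Σ (V G) λ v → Adj G u v

  src tgt : Edge → V G
  src e = proj₁ e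
  tgt e = proj₁ (proj₂ e)

  -- an edge coloring with (at most) m colors: a color for every edge,
  -- independent of orientation and of the adjacency witness
  record EdgeColoring (m : ℕ) : Set where
    field
      col  : Edge → Fin m
      wd   : ∀ u v (p : Adj G u v) (q : Adj G v u) → col (u , v , p) ≡ col (v , u , q)
  open EdgeColoring public

  SameEnds : Edge → Edge → Set
  SameEnds e f = (src e ≡ src f × tgt e ≡ tgt f) ⊎ (src e ≡ tgt f × tgt e ≡ src f)

  Joins : List Edge → V G → V G → Set
  Joins es a b = Any (λ e → (src e ≡ a × tgt e ≡ b) ⊎ (src e ≡ b × tgt e ≡ a)) es

  data Walk (es : List Edge) : V G → V G → Set where
    here : ∀ {a} → Walk es a a
    step : ∀ {a b c} → Joins es a b → Walk es b c → Walk es a c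

  Chain : List Edge → V G → List (V G) → V G → Set
  Chain es x [] end = Joins es x end
  Chain es x (y ∷ ys) end = Joins es x y × Chain es y ys end

  -- a cycle (of length ≥ 3, distinct vertices) in the edge set es
  Cycle : List Edge → Set
  Cycle es = Σ (V G) λ a → Σ (List (V G)) λ ys →
    (2 ≤ length ys) × Unique (a ∷ ys) × Chain es a ys a

  record Tree : Set where
    field
      vs        : List (V G)
      es        : List Edge
      vs-unique : Unique vs
      es-simple : AllPairs (λ e f → ¬ SameEnds e f) es
      es-in-vs  : All (λ e → (src e ∈ vs) × (tgt e ∈ vs)) es
      connected : ∀ a b → a ∈ vs → b ∈ vs → Walk es a b
      acyclic   : ¬ Cycle es
  open Tree public

  Rainbow : ∀ {m} → EdgeColoring m → Tree → Set
  Rainbow c T = AllPairs (λ e f → col c e ≢ col c f) (es T)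

  Is3Rainbow : ∀ {m} → EdgeColoring m → Set
  Is3Rainbow c = ∀ x y z → x ≢ y → x ≢ z → y ≢ z →
    Σ Tree λ T → Rainbow c T × (x ∈ vs T) × (y ∈ vs T) × (z ∈ vs T)

  Rx3≡ : ℕ → Set
  Rx3≡ r = (Σ (EdgeColoring r) Is3Rainbow)
         × (∀ m → (c : EdgeColoring m) → Is3Rainbow c → r ≤ m)

module Submission where

-- The proof is organised around a *frame* of size d on a graph G: a system of d
-- cuts (two-sided partitions of V(G), every edge crossing exactly one cut, its
-- "label"), two vertices lo and hi separated by every cut, and for every three
-- vertices a *spider*: a centre with legs to the three vertices whose edge labels
-- are pairwise distinct.
--   * Upper bound: colouring each edge by its label is 3-rainbow, because the union
--     of the legs of a spider is a tree (a rainbow edge set is acyclic, since a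
--     cycle crosses the cut of each of its edges a second time) and it is rainbow.
--   * Lower bound: a tree containing lo and hi contains a lo–hi walk, which must
--     cross all d cuts; in a rainbow tree these d edges have distinct colours.
-- Hence a frame of size d gives rx₃(G) = d (given a third vertex).  The path P_{n+1}
-- has a frame of size n (cut ℓ separates {0..ℓ} from {ℓ+1..n}; spiders are centred
-- at the median), and frames of G and H combine into a frame of G □ H of size
-- d₁ + d₂.  Induction over the factors yields a frame of size Σ nᵢ − k.

open import Defs
open import Data.Nat using (ℕ; zero; suc; _+_; _*_; _∸_; _≤_; _<_; z≤n; s≤s; s≤s⁻¹; _≤?_; _⊓_; _⊔_; _<ᵇ_)
open import Data.Nat.Properties
  using ( ≤-refl; ≤-reflexive; ≤-trans; <-trans; ≤-<-trans; <-irrefl; <⇒≤; <⇒≱; ≰⇒>; n≤1+n; n<1+n; m≤n+m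
        ; +-suc; +-identityʳ; *-identityʳ; *-identityˡ; *-monoˡ-≤; *-mono-≤; +-mono-≤; +-∸-assoc; m∸n+n≡m
        ; m≤n⇒m⊓n≡m; m≥n⇒m⊓n≡n; m≤n⇒m⊔n≡n; m≥n⇒m⊔n≡m)
open import Data.Fin using (Fin; toℕ; fromℕ<; fromℕ; _↑ˡ_; _↑ʳ_; splitAt)
  renaming (zero to fzero; suc to fsuc)
open import Data.Fin.Properties
  using ( toℕ-injective; toℕ-fromℕ<; toℕ<n; toℕ-fromℕ; injective⇒≤
        ; splitAt-↑ˡ; splitAt-↑ʳ; splitAt⁻¹-↑ˡ; splitAt⁻¹-↑ʳ; ↑ˡ-injective; ↑ʳ-injective)
open import Data.Bool using (Bool; true; false; _≟_)
open import Data.Empty using (⊥; ⊥-elim)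
open import Data.Product using (Σ; _×_; _,_; proj₁; proj₂)
open import Data.Sum using (_⊎_; inj₁; inj₂; [_,_])
open import Data.List using (List; []; _∷_; _++_; map)
open import Data.List.Properties using (map-++)
open import Data.List.Relation.Unary.All as All using (All; []; _∷_)
import Data.List.Relation.Unary.All.Properties as AllP
open import Data.List.Relation.Unary.Any as Any using (here; there)
import Data.List.Relation.Unary.Any.Properties as AnyP
open import Data.List.Relation.Unary.AllPairs as AllPairs using (AllPairs; []; _∷_)
import Data.List.Relation.Unary.AllPairs.Properties as AllPairsP
open import Data.List.Relation.Unary.Unique.Propositional using (Unique)
import Data.List.Relation.Unary.Unique.Propositional.Properties as UniqueP
open import Data.List.Relation.Binary.Disjoint.Propositional using (Disjoint)
open import Data.List.Membership.Propositional using (_∈_; _∉_; find)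
open import Data.List.Membership.Propositional.Properties using (∈-++⁺ˡ; ∈-++⁺ʳ; ∈-++⁻; ∈-map⁻)
open import Data.Vec using (Vec; []; _∷_; sum)
import Data.Vec.Relation.Unary.All as VecAll
open import Relation.Binary.PropositionalEquality
  using (_≡_; _≢_; refl; sym; trans; cong; subst; subst₂)
open import Relation.Nullary using (¬_; yes; no)

distinct⇒injective : ∀ {A B : Set} (g : A → B) {xs : List A} {x y : A} →
  AllPairs (λ a b → g a ≢ g b) xs → x ∈ xs → y ∈ xs → g x ≡ g y → x ≡ y
distinct⇒injective g _ (here refl) (here refl) _ = refl
distinct⇒injective g (d ∷ _) (here refl) (there y∈) gx≡gy = ⊥-elim (All.lookup d y∈ gx≡gy)
distinct⇒injective g (d ∷ _) (there x∈) (here refl) gx≡gy = ⊥-elim (All.lookup d x∈ (sym gx≡gy))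
distinct⇒injective g (_ ∷ ds) (there x∈) (there y∈) gx≡gy = distinct⇒injective g ds x∈ y∈ gx≡gy

module _ (G : Graph) where

  joins-sym : ∀ {es a b} → Joins G es a b → Joins G es b a
  joins-sym = Any.map λ { (inj₁ (p , q)) → inj₂ (p , q) ; (inj₂ (p , q)) → inj₁ (p , q) }

  walk-map : ∀ {es fs} → (∀ {a b} → Joins G es a b → Joins G fs a b) →
    ∀ {a b} → Walk G es a b → Walk G fs a b
  walk-map f here = here
  walk-map f (step j w) = step (f j) (walk-map f w)

  walk-++ : ∀ {es a b c} → Walk G es a b → Walk G es b c → Walk G es a c
  walk-++ here w = w
  walk-++ (step j v) w = step j (walk-++ v w)

  walk-reverse : ∀ {es a b} → Walk G es a b → Walk G es b a
  walk-reverse here = here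
  walk-reverse (step j w) = walk-++ (walk-reverse w) (step (joins-sym j) here)

  data Leg : V G → V G → Set where
    []  : ∀ {a} → Leg a a
    _∷_ : ∀ {a b c} → Adj G a b → Leg b c → Leg a c

  legEdges : ∀ {a b} → Leg a b → List (Edge G)
  legEdges [] = []
  legEdges (_∷_ {a} {b} p l) = (a , b , p) ∷ legEdges l

  visited : ∀ {a b} → Leg a b → List (V G)
  visited [] = []
  visited (_∷_ {b = b} p l) = b ∷ visited l

  _++ᴸ_ : ∀ {a b c} → Leg a b → Leg b c → Leg a c
  [] ++ᴸ l = l
  (p ∷ k) ++ᴸ l = p ∷ (k ++ᴸ l)

  legEdges-++ : ∀ {a b c} (k : Leg a b) (l : Leg b c) → legEdges (k ++ᴸ l) ≡ legEdges k ++ legEdges l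
  legEdges-++ [] l = refl
  legEdges-++ (p ∷ k) l = cong (_ ∷_) (legEdges-++ k l)

  leg-walk : ∀ {a b} (l : Leg a b) {v} → v ∈ a ∷ visited l → Walk G (legEdges l) a v
  leg-walk l (here refl) = here
  leg-walk (p ∷ l) (there v∈) = step (here (inj₁ (refl , refl))) (walk-map there (leg-walk l v∈))

  leg-edges-inside : ∀ {a b} (l : Leg a b) →
    All (λ e → (src G e ∈ a ∷ visited l) × (tgt G e ∈ visited l)) (legEdges l)
  leg-edges-inside [] = []
  leg-edges-inside (p ∷ l) =
    (here refl , here refl) ∷ All.map (λ { (s , t) → there s , there t }) (leg-edges-inside l)

  leg-end : ∀ {a b} (l : Leg a b) → b ∈ a ∷ visited l
  leg-end [] = here refl
  leg-end (p ∷ l) = there (leg-end l)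

  record CutSystem (d : ℕ) : Set where
    field
      label : Edge G → Fin d
      side  : Fin d → V G → Bool
      crossing⇒label : ∀ e ℓ → side ℓ (src G e) ≢ side ℓ (tgt G e) → label e ≡ ℓ
      label⇒crossing : ∀ e → side (label e) (src G e) ≢ side (label e) (tgt G e)

  record Spider {d : ℕ} (L : Edge G → Fin d) (x y z : V G) : Set where
    field
      centre : V G
      leg-x : Leg centre x
      leg-y : Leg centre y
      leg-z : Leg centre z
      unique-x : Unique (map L (legEdges leg-x))
      unique-y : Unique (map L (legEdges leg-y))
      unique-z : Unique (map L (legEdges leg-z))
      disjoint-xy : Disjoint (map L (legEdges leg-x)) (map L (legEdges leg-y))
      disjoint-xz : Disjoint (map L (legEdges leg-x)) (map L (legEdges leg-z))
      disjoint-yz : Disjoint (map L (legEdges leg-y)) (map L (legEdges leg-z))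

  module CutTheory {d : ℕ} (C : CutSystem d) where
    open CutSystem C

    Rainbowᴸ : List (Edge G) → Set
    Rainbowᴸ = AllPairs (λ e f → label e ≢ label f)

    labels : ∀ {a b} → Leg a b → List (Fin d)
    labels l = map label (legEdges l)

    label-sameEnds : ∀ e f → SameEnds G e f → label e ≡ label f
    label-sameEnds e f (inj₁ (s≡s , t≡t)) = sym (crossing⇒label f (label e) λ same →
      label⇒crossing e (trans (cong (side (label e)) s≡s) (trans same (cong (side (label e)) (sym t≡t)))))
    label-sameEnds e f (inj₂ (s≡t , t≡s)) = sym (crossing⇒label f (label e) λ same →
      label⇒crossing e (trans (cong (side (label e)) s≡t) (trans (sym same) (cong (side (label e)) (sym t≡s)))))

    step-keeps-side : ∀ {a b} (p : Adj G a b) ℓ → label (a , b , p) ≢ ℓ → side ℓ a ≡ side ℓ b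
    step-keeps-side p ℓ ≢ℓ with side ℓ _ ≟ side ℓ _
    ... | yes same = same
    ... | no differ = ⊥-elim (≢ℓ (crossing⇒label _ ℓ differ))

    leg-keeps-side : ∀ {a b} (l : Leg a b) ℓ → ℓ ∉ labels l → All (λ v → side ℓ v ≡ side ℓ a) (visited l)
    leg-keeps-side [] ℓ _ = []
    leg-keeps-side (p ∷ l) ℓ ℓ∉ =
      let a~b = step-keeps-side p ℓ (λ q → ℓ∉ (here (sym q))) in
      sym a~b ∷ All.map (λ q → trans q (sym a~b)) (leg-keeps-side l ℓ (λ q → ℓ∉ (there q)))

    -- On a leg with distinct labels, every visited vertex is separated from the
    -- start by the cut of some label of the leg (the label of the step reaching it).
    leg-separates : ∀ {a b} (l : Leg a b) → Unique (labels l) → ∀ {v} → v ∈ visited l →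
      Σ (Fin d) λ ℓ → ℓ ∈ labels l × side ℓ v ≢ side ℓ a
    leg-separates (p ∷ l) u (here refl) = label (_ , _ , p) , here refl , λ q → label⇒crossing _ (sym q)
    leg-separates (p ∷ l) (h ∷ u) (there v∈) with leg-separates l u v∈
    ... | ℓ , ℓ∈ , ≢side = ℓ , there ℓ∈ , λ q → ≢side (trans q (step-keeps-side p ℓ (All.lookup h ℓ∈)))

    leg-vertices-unique : ∀ {a b} (l : Leg a b) → Unique (labels l) → Unique (a ∷ visited l)
    leg-vertices-unique [] _ = [] ∷ []
    leg-vertices-unique (p ∷ l) u@(_ ∷ u') =
      All.tabulate (λ v∈ a≡v → proj₂ (proj₂ (leg-separates (p ∷ l) u v∈)) (cong (side _) (sym a≡v)))
      ∷ leg-vertices-unique l u'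

    legs-disjoint : ∀ {a b c} (k : Leg a b) (l : Leg a c) → Unique (labels k) →
      Disjoint (labels k) (labels l) → Disjoint (visited k) (visited l)
    legs-disjoint k l uk k#l (v∈k , v∈l) with leg-separates k uk v∈k
    ... | ℓ , ℓ∈ , ≢side = ≢side (All.lookup (leg-keeps-side l ℓ (λ ℓ∈l → k#l (ℓ∈ , ℓ∈l))) v∈l)

    Links : Edge G → V G → V G → Set
    Links f u v = (src G f ≡ u × tgt G f ≡ v) ⊎ (src G f ≡ v × tgt G f ≡ u)

    links-cross : ∀ {f a b} → Links f a b → side (label f) a ≢ side (label f) b
    links-cross {f} (inj₁ (refl , refl)) = label⇒crossing f
    links-cross {f} (inj₂ (refl , refl)) q = label⇒crossing f (sym q)

    links-unique : ∀ {f a b u v} → Links f a b → Links f u v → (u ≡ a × v ≡ b) ⊎ (u ≡ b × v ≡ a)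
    links-unique (inj₁ (refl , refl)) (inj₁ (refl , refl)) = inj₁ (refl , refl)
    links-unique (inj₁ (refl , refl)) (inj₂ (refl , refl)) = inj₂ (refl , refl)
    links-unique (inj₂ (refl , refl)) (inj₁ (refl , refl)) = inj₂ (refl , refl)
    links-unique (inj₂ (refl , refl)) (inj₂ (refl , refl)) = inj₁ (refl , refl)

    joins-cross : ∀ {es u v} ℓ → Joins G es u v → side ℓ u ≢ side ℓ v →
      Σ (Edge G) λ f → f ∈ es × label f ≡ ℓ × Links f u v
    joins-cross ℓ j ≢side with find j
    ... | f , f∈ , inj₁ (refl , refl) = f , f∈ , crossing⇒label f ℓ ≢side , inj₁ (refl , refl)
    ... | f , f∈ , inj₂ (refl , refl) = f , f∈ , crossing⇒label f ℓ (λ q → ≢side (sym q)) , inj₂ (refl , refl)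

    walk-crosses : ∀ {es a b} ℓ → Walk G es a b → side ℓ a ≢ side ℓ b →
      Σ (Edge G) λ f → f ∈ es × label f ≡ ℓ
    walk-crosses ℓ here ≢side = ⊥-elim (≢side refl)
    walk-crosses {a = a} ℓ (step {b = b} j w) ≢side with side ℓ a ≟ side ℓ b
    ... | yes same = walk-crosses ℓ w (λ q → ≢side (trans same q))
    ... | no differ = let f , f∈ , fℓ , _ = joins-cross ℓ j differ in f , f∈ , fℓ

    consecutive : V G → List (V G) → V G → List (V G × V G)
    consecutive x [] end = (x , end) ∷ []
    consecutive x (y ∷ ys) end = (x , y) ∷ consecutive y ys end

    consecutive-inside : ∀ x ys end {u v} → (u , v) ∈ consecutive x ys end →
      (u ∈ x ∷ ys ++ end ∷ []) × (v ∈ x ∷ ys ++ end ∷ [])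
    consecutive-inside x [] end (here refl) = here refl , there (here refl)
    consecutive-inside x (y ∷ ys) end (here refl) = here refl , there (here refl)
    consecutive-inside x (y ∷ ys) end (there uv∈) =
      let u∈ , v∈ = consecutive-inside y ys end uv∈ in there u∈ , there v∈

    chain-crosses : ∀ {es} ℓ x ys end → Chain G es x ys end → side ℓ x ≢ side ℓ end →
      Σ (Edge G) λ f → f ∈ es × label f ≡ ℓ ×
        Σ (V G × V G) λ uv → uv ∈ consecutive x ys end × Links f (proj₁ uv) (proj₂ uv)
    chain-crosses ℓ x [] end j ≢side =
      let f , f∈ , fℓ , links = joins-cross ℓ j ≢side in f , f∈ , fℓ , _ , here refl , links
    chain-crosses ℓ x (y ∷ ys) end (j , ch) ≢side with side ℓ x ≟ side ℓ y
    ... | yes same =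
      let f , f∈ , fℓ , uv , uv∈ , links = chain-crosses ℓ y ys end ch (λ q → ≢side (trans same q))
      in f , f∈ , fℓ , uv , there uv∈ , links
    ... | no differ =
      let f , f∈ , fℓ , links = joins-cross ℓ j differ in f , f∈ , fℓ , _ , here refl , links

    -- A rainbow edge set has no cycle: the cut of the edge a–y of a cycle
    -- a, y, r, …, a must be crossed again by the rest of the cycle, by an edge of
    -- the same label, hence the same edge, which would repeat a or y.
    rainbow⇒acyclic : ∀ {es} → Rainbowᴸ es → ¬ Cycle G es
    rainbow⇒acyclic rb (a , [] , () , _)
    rainbow⇒acyclic rb (a , y ∷ [] , s≤s () , _)
    rainbow⇒acyclic rb (a , y ∷ r ∷ rs , _ , (a∉ ∷ y∉ ∷ _) , (j , rest))
      with find j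
    ... | f , f∈ , links₁
      with chain-crosses (label f) y (r ∷ rs) a rest (λ q → links-cross links₁ (sym q))
    ... | f′ , f′∈ , f′ℓ , (u , v) , uv∈ , links₂
      with distinct⇒injective label rb f∈ f′∈ (sym f′ℓ)
    ... | refl = repeats uv∈ (links-unique {f = f} links₁ links₂)
      where
      y∉later : y ∉ r ∷ rs ++ a ∷ []
      y∉later y∈ with ∈-++⁻ (r ∷ rs) y∈
      ... | inj₁ y∈rs = All.lookup y∉ y∈rs refl
      ... | inj₂ (here y≡a) = All.lookup a∉ (here refl) (sym y≡a)
      repeats : (u , v) ∈ consecutive y (r ∷ rs) a → (u ≡ a × v ≡ y) ⊎ (u ≡ y × v ≡ a) → ⊥
      repeats (here refl) (inj₁ (y≡a , _)) = All.lookup a∉ (here refl) (sym y≡a)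
      repeats (here refl) (inj₂ (_ , r≡a)) = All.lookup a∉ (there (here refl)) (sym r≡a)
      repeats (there uv∈′) (inj₁ (_ , refl)) = y∉later (proj₂ (consecutive-inside r rs a uv∈′))
      repeats (there uv∈′) (inj₂ (refl , _)) = y∉later (proj₁ (consecutive-inside r rs a uv∈′))

    module SpiderUnion {x y z} (S : Spider label x y z) where
      open Spider S

      vertices : List (V G)
      vertices = centre ∷ (visited leg-x ++ visited leg-y ++ visited leg-z)

      edges : List (Edge G)
      edges = legEdges leg-x ++ legEdges leg-y ++ legEdges leg-z

      on-x : ∀ {v} → v ∈ centre ∷ visited leg-x → v ∈ vertices
      on-x (here q) = here q
      on-x (there v∈) = there (∈-++⁺ˡ v∈)

      on-y : ∀ {v} → v ∈ centre ∷ visited leg-y → v ∈ vertices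
      on-y (here q) = here q
      on-y (there v∈) = there (∈-++⁺ʳ (visited leg-x) (∈-++⁺ˡ v∈))

      on-z : ∀ {v} → v ∈ centre ∷ visited leg-z → v ∈ vertices
      on-z (here q) = here q
      on-z (there v∈) = there (∈-++⁺ʳ (visited leg-x) (∈-++⁺ʳ (visited leg-y) v∈))

      rainbow : Rainbowᴸ edges
      rainbow = AllPairsP.map⁻ unique-labels
        where
        x#yz : Disjoint (labels leg-x) (labels leg-y ++ labels leg-z)
        x#yz (ℓ∈x , ℓ∈yz) with ∈-++⁻ (labels leg-y) ℓ∈yz
        ... | inj₁ ℓ∈y = disjoint-xy (ℓ∈x , ℓ∈y)
        ... | inj₂ ℓ∈z = disjoint-xz (ℓ∈x , ℓ∈z)
        unique-labels : Unique (map label edges)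
        unique-labels
          rewrite map-++ label (legEdges leg-x) (legEdges leg-y ++ legEdges leg-z)
                | map-++ label (legEdges leg-y) (legEdges leg-z) =
          UniqueP.++⁺ unique-x (UniqueP.++⁺ unique-y unique-z disjoint-yz) x#yz

      vertices-unique : Unique vertices
      vertices-unique =
        AllP.++⁺ (AllPairs.head ux) (AllP.++⁺ (AllPairs.head uy) (AllPairs.head uz))
        ∷ UniqueP.++⁺ (AllPairs.tail ux)
            (UniqueP.++⁺ (AllPairs.tail uy) (AllPairs.tail uz) (legs-disjoint leg-y leg-z unique-y disjoint-yz))
            x#yz
        where
        ux = leg-vertices-unique leg-x unique-x
        uy = leg-vertices-unique leg-y unique-y
        uz = leg-vertices-unique leg-z unique-z
        x#yz : Disjoint (visited leg-x) (visited leg-y ++ visited leg-z)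
        x#yz (v∈x , v∈yz) with ∈-++⁻ (visited leg-y) v∈yz
        ... | inj₁ v∈y = legs-disjoint leg-x leg-y unique-x disjoint-xy (v∈x , v∈y)
        ... | inj₂ v∈z = legs-disjoint leg-x leg-z unique-x disjoint-xz (v∈x , v∈z)

      from-centre : ∀ {v} → v ∈ vertices → Walk G edges centre v
      from-centre (here refl) = here
      from-centre (there v∈) with ∈-++⁻ (visited leg-x) v∈
      ... | inj₁ v∈x = walk-map AnyP.++⁺ˡ (leg-walk leg-x (there v∈x))
      ... | inj₂ v∈yz with ∈-++⁻ (visited leg-y) v∈yz
      ...   | inj₁ v∈y = walk-map (λ j → AnyP.++⁺ʳ (legEdges leg-x) (AnyP.++⁺ˡ j)) (leg-walk leg-y (there v∈y))
      ...   | inj₂ v∈z = walk-map (λ j → AnyP.++⁺ʳ (legEdges leg-x) (AnyP.++⁺ʳ (legEdges leg-y) j)) (leg-walk leg-z (there v∈z))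

      edges-inside : All (λ e → (src G e ∈ vertices) × (tgt G e ∈ vertices)) edges
      edges-inside =
        AllP.++⁺ (All.map (λ { (s , t) → on-x s , on-x (there t) }) (leg-edges-inside leg-x))
          (AllP.++⁺ (All.map (λ { (s , t) → on-y s , on-y (there t) }) (leg-edges-inside leg-y))
                    (All.map (λ { (s , t) → on-z s , on-z (there t) }) (leg-edges-inside leg-z)))

      tree : Tree G
      tree = record
        { vs = vertices
        ; es = edges
        ; vs-unique = vertices-unique
        ; es-simple = AllPairs.map (λ {e} {f} ≢label same → ≢label (label-sameEnds e f same)) rainbow
        ; es-in-vs = edges-inside
        ; connected = λ a b a∈ b∈ → walk-++ (walk-reverse (from-centre a∈)) (from-centre b∈)
        ; acyclic = rainbow⇒acyclic rainbow
        }

      contains-x : x ∈ vertices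
      contains-x = on-x (leg-end leg-x)

      contains-y : y ∈ vertices
      contains-y = on-y (leg-end leg-y)

      contains-z : z ∈ vertices
      contains-z = on-z (leg-end leg-z)

  record Frame (d s : ℕ) : Set where
    field
      cuts : CutSystem d
      lo hi : V G
      lo-side : ∀ ℓ → CutSystem.side cuts ℓ lo ≡ false
      hi-side : ∀ ℓ → CutSystem.side cuts ℓ hi ≡ true
      lo≢hi : 2 ≤ s → lo ≢ hi
      third : 3 ≤ s → Σ (V G) λ z → z ≢ lo × z ≢ hi
      spider : ∀ x y z → Spider (CutSystem.label cuts) x y z

  module FrameTheory {d s : ℕ} (F : Frame d s) where
    open Frame F
    open CutSystem cuts
    open CutTheory cuts

    labelColoring : EdgeColoring G d
    labelColoring = record
      { col = label
      ; wd = λ u v p q → label-sameEnds (u , v , p) (v , u , q) (inj₂ (refl , refl)) }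

    -- Upper bound: the union of a spider is a rainbow tree for the label colouring.
    labelColoring-3rainbow : Is3Rainbow G labelColoring
    labelColoring-3rainbow x y z _ _ _ =
      tree , rainbow , contains-x , contains-y , contains-z
      where open SpiderUnion (spider x y z)

    -- Lower bound: a rainbow tree through lo, hi (and a third vertex) contains an
    -- edge of every label; their colours are distinct, giving an injection Fin d → Fin m.
    at-least-d-colours : 3 ≤ s → ∀ m (c : EdgeColoring G m) → Is3Rainbow G c → d ≤ m
    at-least-d-colours 3≤s m c c-3rainbow = injective⇒≤ {f = colourOf} colourOf-injective
      where
      z = proj₁ (third 3≤s)
      z≢lo = proj₁ (proj₂ (third 3≤s))
      z≢hi = proj₂ (proj₂ (third 3≤s))
      found = c-3rainbow lo hi z (lo≢hi (≤-trans (n≤1+n 2) 3≤s)) (λ q → z≢lo (sym q)) (λ q → z≢hi (sym q))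
      T = proj₁ found
      T-rainbow = proj₁ (proj₂ found)
      lo→hi : Walk G (es T) lo hi
      lo→hi = connected T lo hi (proj₁ (proj₂ (proj₂ found))) (proj₁ (proj₂ (proj₂ (proj₂ found))))
      edgeOf : (ℓ : Fin d) → Σ (Edge G) λ f → f ∈ es T × label f ≡ ℓ
      edgeOf ℓ = walk-crosses ℓ lo→hi λ q → false≢true (trans (sym (lo-side ℓ)) (trans q (hi-side ℓ)))
        where
        false≢true : false ≢ true
        false≢true ()
      colourOf : Fin d → Fin m
      colourOf ℓ = col c (proj₁ (edgeOf ℓ))
      colourOf-injective : ∀ {ℓ ℓ′} → colourOf ℓ ≡ colourOf ℓ′ → ℓ ≡ ℓ′
      colourOf-injective {ℓ} {ℓ′} same-colour =
        let _ , f∈ , fℓ = edgeOf ℓ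
            _ , f′∈ , f′ℓ′ = edgeOf ℓ′
        in trans (sym fℓ) (trans (cong label (distinct⇒injective (col c) T-rainbow f∈ f′∈ same-colour)) f′ℓ′)

    frame⇒rx3 : 3 ≤ s → Rx3≡ G d
    frame⇒rx3 3≤s = (labelColoring , labelColoring-3rainbow) , at-least-d-colours 3≤s

-- The path P_{n+1} on vertices 0, …, n has a frame of size n: the edge i–(i+1) is
-- labelled i, and cut ℓ puts the vertices v ≤ ℓ on one side, v > ℓ on the other.
module PathFrame (n : ℕ) where

  P : Graph
  P = Path (suc n)

  threshold-step : ∀ ℓ v → (ℓ <ᵇ v) ≢ (ℓ <ᵇ suc v) → ℓ ≡ v
  threshold-step zero zero _ = refl
  threshold-step zero (suc v) differ = ⊥-elim (differ refl)
  threshold-step (suc ℓ) zero differ with ℓ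
  ... | zero = ⊥-elim (differ refl)
  ... | suc _ = ⊥-elim (differ refl)
  threshold-step (suc ℓ) (suc v) differ = cong suc (threshold-step ℓ v differ)

  threshold-passes : ∀ v → (v <ᵇ v) ≢ (v <ᵇ suc v)
  threshold-passes zero ()
  threshold-passes (suc v) = threshold-passes v

  threshold-above : ∀ {ℓ v} → ℓ < v → (ℓ <ᵇ v) ≡ true
  threshold-above {zero} (s≤s _) = refl
  threshold-above {suc ℓ} (s≤s ℓ<v@(s≤s _)) = threshold-above ℓ<v

  stepLabel : (a b : Fin (suc n)) → suc (toℕ a) ≡ toℕ b → Fin n
  stepLabel a b a+1≡b = fromℕ< (subst (_≤ n) (sym a+1≡b) (s≤s⁻¹ (toℕ<n b)))

  stepLabel-value : ∀ a b a+1≡b → toℕ (stepLabel a b a+1≡b) ≡ toℕ a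
  stepLabel-value a b a+1≡b = toℕ-fromℕ< _

  label : Edge P → Fin n
  label (u , v , inj₁ u+1≡v) = stepLabel u v u+1≡v
  label (u , v , inj₂ v+1≡u) = stepLabel v u v+1≡u

  side : Fin n → Fin (suc n) → Bool
  side ℓ v = toℕ ℓ <ᵇ toℕ v

  crossing⇒label : ∀ e ℓ → side ℓ (src P e) ≢ side ℓ (tgt P e) → label e ≡ ℓ
  crossing⇒label (u , v , inj₁ u+1≡v) ℓ differ = toℕ-injective (trans (stepLabel-value u v u+1≡v)
    (sym (threshold-step (toℕ ℓ) (toℕ u) λ q → differ (trans q (cong (toℕ ℓ <ᵇ_) u+1≡v)))))
  crossing⇒label (u , v , inj₂ v+1≡u) ℓ differ = toℕ-injective (trans (stepLabel-value v u v+1≡u)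
    (sym (threshold-step (toℕ ℓ) (toℕ v) λ q → differ (sym (trans q (cong (toℕ ℓ <ᵇ_) v+1≡u))))))

  label⇒crossing : ∀ e → side (label e) (src P e) ≢ side (label e) (tgt P e)
  label⇒crossing (u , v , inj₁ u+1≡v) same = threshold-passes (toℕ u)
    (subst (λ w → (w <ᵇ toℕ u) ≡ (w <ᵇ suc (toℕ u))) (stepLabel-value u v u+1≡v)
      (trans same (cong (toℕ (stepLabel u v u+1≡v) <ᵇ_) (sym u+1≡v))))
  label⇒crossing (u , v , inj₂ v+1≡u) same = threshold-passes (toℕ v)
    (subst (λ w → (w <ᵇ toℕ v) ≡ (w <ᵇ suc (toℕ v))) (stepLabel-value v u v+1≡u)
      (trans (sym same) (cong (toℕ (stepLabel v u v+1≡u) <ᵇ_) (sym v+1≡u))))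

  cuts : CutSystem P n
  cuts = record { label = label ; side = side ; crossing⇒label = crossing⇒label ; label⇒crossing = label⇒crossing }

  labels : ∀ {a b} → Leg P a b → List (Fin n)
  labels l = map label (legEdges P l)

  Within : ℕ → ℕ → Fin n → Set
  Within lo hi ℓ = lo ≤ toℕ ℓ × toℕ ℓ < hi

  LabelsIn : ℕ → ℕ → List (Fin n) → Set
  LabelsIn lo hi ls = Unique ls × All (Within lo hi) ls

  labelsIn-∷-low : ∀ {ℓ lo lo′ hi ls} → toℕ ℓ ≡ lo → suc lo ≡ lo′ → lo < hi →
    LabelsIn lo′ hi ls → LabelsIn lo hi (ℓ ∷ ls)
  labelsIn-∷-low refl refl ℓ<hi (u , within) =
    All.map (λ { (ℓ<ℓ′ , _) ℓ≡ℓ′ → <-irrefl (cong toℕ ℓ≡ℓ′) ℓ<ℓ′ }) within ∷ u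
    , (≤-refl , ℓ<hi) ∷ All.map (λ { (ℓ<ℓ′ , ℓ′<hi) → <⇒≤ ℓ<ℓ′ , ℓ′<hi }) within

  labelsIn-∷-high : ∀ {ℓ lo m hi ls} → toℕ ℓ ≡ m → suc m ≡ hi → lo ≤ m →
    LabelsIn lo m ls → LabelsIn lo hi (ℓ ∷ ls)
  labelsIn-∷-high refl refl lo≤ℓ (u , within) =
    All.map (λ { (_ , ℓ′<ℓ) ℓ≡ℓ′ → <-irrefl (cong toℕ (sym ℓ≡ℓ′)) ℓ′<ℓ }) within ∷ u
    , (lo≤ℓ , n<1+n _) ∷ All.map (λ { (lo≤ℓ′ , ℓ′<ℓ) → lo≤ℓ′ , <-trans ℓ′<ℓ (n<1+n _) }) within

  ascend : ∀ k (a b : Fin (suc n)) → toℕ b ≡ k + toℕ a →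
    Σ (Leg P a b) λ l → LabelsIn (toℕ a) (toℕ b) (labels l)
  ascend zero a b b≡a with toℕ-injective {i = a} {j = b} (sym b≡a)
  ... | refl = [] , [] , []
  ascend (suc k) a b b≡k+1+a =
    let l , labelsIn = ascend k a′ b b≡k+a′
    in inj₁ a+1≡a′ ∷ l , labelsIn-∷-low (stepLabel-value a a′ a+1≡a′) a+1≡a′ a<b labelsIn
    where
    a<b : toℕ a < toℕ b
    a<b = subst (toℕ a <_) (sym b≡k+1+a) (s≤s (m≤n+m (toℕ a) k))
    a+1<n+1 : suc (toℕ a) < suc n
    a+1<n+1 = ≤-<-trans a<b (toℕ<n b)
    a′ = fromℕ< a+1<n+1
    a+1≡a′ : suc (toℕ a) ≡ toℕ a′
    a+1≡a′ = sym (toℕ-fromℕ< a+1<n+1)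
    b≡k+a′ : toℕ b ≡ k + toℕ a′
    b≡k+a′ = trans b≡k+1+a (trans (sym (+-suc k (toℕ a))) (cong (k +_) a+1≡a′))

  descend : ∀ k (a b : Fin (suc n)) → toℕ a ≡ k + toℕ b →
    Σ (Leg P a b) λ l → LabelsIn (toℕ b) (toℕ a) (labels l)
  descend zero a b a≡b with toℕ-injective {i = a} {j = b} a≡b
  ... | refl = [] , [] , []
  descend (suc k) a b a≡k+1+b =
    let l , labelsIn = descend k a′ b a′≡k+b
    in inj₂ a′+1≡a ∷ l
       , labelsIn-∷-high (trans (stepLabel-value a′ a a′+1≡a) a′≡k+b) (sym a≡k+1+b) (m≤n+m (toℕ b) k)
           (subst (λ t → LabelsIn (toℕ b) t (labels l)) a′≡k+b labelsIn)
    where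
    k+b<n+1 : k + toℕ b < suc n
    k+b<n+1 = <-trans (subst (k + toℕ b <_) (sym a≡k+1+b) (n<1+n _)) (toℕ<n a)
    a′ = fromℕ< k+b<n+1
    a′≡k+b : toℕ a′ ≡ k + toℕ b
    a′≡k+b = toℕ-fromℕ< k+b<n+1
    a′+1≡a : suc (toℕ a′) ≡ toℕ a
    a′+1≡a = trans (cong suc a′≡k+b) (sym a≡k+1+b)

  legBetween : (a b : Fin (suc n)) →
    Σ (Leg P a b) λ l → LabelsIn (toℕ a ⊓ toℕ b) (toℕ a ⊔ toℕ b) (labels l)
  legBetween a b with toℕ a ≤? toℕ b
  ... | yes a≤b = subst₂ (λ lo hi → Σ (Leg P a b) λ l → LabelsIn lo hi (labels l))
                    (sym (m≤n⇒m⊓n≡m a≤b)) (sym (m≤n⇒m⊔n≡n a≤b))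
                    (ascend (toℕ b ∸ toℕ a) a b (sym (m∸n+n≡m a≤b)))
  ... | no a≰b = subst₂ (λ lo hi → Σ (Leg P a b) λ l → LabelsIn lo hi (labels l))
                    (sym (m≥n⇒m⊓n≡n b≤a)) (sym (m≥n⇒m⊔n≡m b≤a))
                    (descend (toℕ a ∸ toℕ b) a b (sym (m∸n+n≡m b≤a)))
    where b≤a = <⇒≤ (≰⇒> a≰b)

  Between : ℕ → ℕ → ℕ → Set
  Between a m b = (a ≤ m × m ≤ b) ⊎ (b ≤ m × m ≤ a)

  opposite-intervals-disjoint : ∀ {a m b} {ls ls′ : List (Fin n)} → Between a m b →
    All (Within (m ⊓ a) (m ⊔ a)) ls → All (Within (m ⊓ b) (m ⊔ b)) ls′ → Disjoint ls ls′
  opposite-intervals-disjoint (inj₁ (a≤m , m≤b)) in-a in-b (ℓ∈ , ℓ∈′) =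
    <⇒≱ (subst (_ <_) (m≥n⇒m⊔n≡m a≤m) (proj₂ (All.lookup in-a ℓ∈)))
        (subst (_≤ _) (m≤n⇒m⊓n≡m m≤b) (proj₁ (All.lookup in-b ℓ∈′)))
  opposite-intervals-disjoint (inj₂ (b≤m , m≤a)) in-a in-b (ℓ∈ , ℓ∈′) =
    <⇒≱ (subst (_ <_) (m≥n⇒m⊔n≡m b≤m) (proj₂ (All.lookup in-b ℓ∈′)))
        (subst (_≤ _) (m≤n⇒m⊓n≡m m≤a) (proj₁ (All.lookup in-a ℓ∈)))

  median : (x y z : Fin (suc n)) → Σ (Fin (suc n)) λ m →
    Between (toℕ x) (toℕ m) (toℕ y) × Between (toℕ x) (toℕ m) (toℕ z) × Between (toℕ y) (toℕ m) (toℕ z)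
  median x y z with toℕ x ≤? toℕ y | toℕ y ≤? toℕ z | toℕ x ≤? toℕ z
  ... | yes x≤y | yes y≤z | _ = y , inj₁ (x≤y , ≤-refl) , inj₁ (x≤y , y≤z) , inj₁ (≤-refl , y≤z)
  ... | yes x≤y | no y≰z | yes x≤z =
    z , inj₁ (x≤z , z≤y) , inj₁ (x≤z , ≤-refl) , inj₂ (≤-refl , z≤y)
    where z≤y = <⇒≤ (≰⇒> y≰z)
  ... | yes x≤y | no y≰z | no x≰z =
    x , inj₁ (≤-refl , x≤y) , inj₂ (z≤x , ≤-refl) , inj₂ (z≤x , x≤y)
    where z≤x = <⇒≤ (≰⇒> x≰z)
  ... | no x≰y | _ | yes x≤z =
    x , inj₂ (y≤x , ≤-refl) , inj₁ (≤-refl , x≤z) , inj₁ (y≤x , x≤z)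
    where y≤x = <⇒≤ (≰⇒> x≰y)
  ... | no x≰y | yes y≤z | no x≰z =
    z , inj₂ (y≤z , z≤x) , inj₂ (≤-refl , z≤x) , inj₁ (y≤z , ≤-refl)
    where z≤x = <⇒≤ (≰⇒> x≰z)
  ... | no x≰y | no y≰z | no x≰z =
    y , inj₂ (≤-refl , y≤x) , inj₂ (z≤y , y≤x) , inj₂ (z≤y , ≤-refl)
    where y≤x = <⇒≤ (≰⇒> x≰y)
          z≤y = <⇒≤ (≰⇒> y≰z)

  spider : ∀ x y z → Spider P label x y z
  spider x y z = record
    { centre = m ; leg-x = proj₁ to-x ; leg-y = proj₁ to-y ; leg-z = proj₁ to-z
    ; unique-x = proj₁ (proj₂ to-x) ; unique-y = proj₁ (proj₂ to-y) ; unique-z = proj₁ (proj₂ to-z)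
    ; disjoint-xy = opposite-intervals-disjoint m∈xy (proj₂ (proj₂ to-x)) (proj₂ (proj₂ to-y))
    ; disjoint-xz = opposite-intervals-disjoint m∈xz (proj₂ (proj₂ to-x)) (proj₂ (proj₂ to-z))
    ; disjoint-yz = opposite-intervals-disjoint m∈yz (proj₂ (proj₂ to-y)) (proj₂ (proj₂ to-z)) }
    where
    m = proj₁ (median x y z)
    m∈xy = proj₁ (proj₂ (median x y z))
    m∈xz = proj₁ (proj₂ (proj₂ (median x y z)))
    m∈yz = proj₂ (proj₂ (proj₂ (median x y z)))
    to-x = legBetween m x
    to-y = legBetween m y
    to-z = legBetween m z

  frame : Frame P n (suc n)
  frame = record
    { cuts = cuts
    ; lo = fzero
    ; hi = fromℕ n
    ; lo-side = λ ℓ → refl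
    ; hi-side = λ ℓ → threshold-above (subst (toℕ ℓ <_) (sym (toℕ-fromℕ n)) (toℕ<n ℓ))
    ; lo≢hi = 0≢n
    ; third = middle
    ; spider = spider }
    where
    0≢n : 2 ≤ suc n → fzero ≢ fromℕ n
    0≢n (s≤s (s≤s _)) ()
    middle : 3 ≤ suc n → Σ (Fin (suc n)) λ z → z ≢ fzero × z ≢ fromℕ n
    middle (s≤s (s≤s (s≤s _))) = fsuc fzero , (λ ()) , (λ ())

module LabelSum (d₁ d₂ : ℕ) where

  merge : List (Fin d₁) → List (Fin d₂) → List (Fin (d₁ + d₂))
  merge A B = map (_↑ˡ d₂) A ++ map (d₁ ↑ʳ_) B

  left≢right : ∀ (i : Fin d₁) j → i ↑ˡ d₂ ≢ d₁ ↑ʳ j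
  left≢right i j i≡j
    with trans (sym (splitAt-↑ˡ d₁ i d₂)) (trans (cong (splitAt d₁) i≡j) (splitAt-↑ʳ d₁ d₂ j))
  ... | ()

  left#right : ∀ {A B} → Disjoint (map (_↑ˡ d₂) A) (map (d₁ ↑ʳ_) B)
  left#right (ℓ∈A , ℓ∈B) with ∈-map⁻ (_↑ˡ d₂) ℓ∈A | ∈-map⁻ (d₁ ↑ʳ_) ℓ∈B
  ... | i , _ , refl | j , _ , i≡j = left≢right i j i≡j

  merge-unique : ∀ {A B} → Unique A → Unique B → Unique (merge A B)
  merge-unique uA uB =
    UniqueP.++⁺ (UniqueP.map⁺ (λ {i} {j} → ↑ˡ-injective d₂ i j) uA)
                (UniqueP.map⁺ (λ {i} {j} → ↑ʳ-injective d₁ i j) uB)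
                left#right

  map-disjoint : ∀ {k} {A A′ : List (Fin k)} (f : Fin k → Fin (d₁ + d₂)) →
    (∀ {i j} → f i ≡ f j → i ≡ j) → Disjoint A A′ → Disjoint (map f A) (map f A′)
  map-disjoint f f-injective A#A′ (ℓ∈ , ℓ∈′) with ∈-map⁻ f ℓ∈ | ∈-map⁻ f ℓ∈′
  ... | i , i∈ , refl | j , j∈ , fi≡fj with f-injective fi≡fj
  ... | refl = A#A′ (i∈ , j∈)

  merge-disjoint : ∀ {A B A′ B′} → Disjoint A A′ → Disjoint B B′ → Disjoint (merge A B) (merge A′ B′)
  merge-disjoint {A} {B} {A′} {B′} A#A′ B#B′ (ℓ∈ , ℓ∈′)
    with ∈-++⁻ (map (_↑ˡ d₂) A) ℓ∈ | ∈-++⁻ (map (_↑ˡ d₂) A′) ℓ∈′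
  ... | inj₁ ℓ∈A | inj₁ ℓ∈A′ = map-disjoint (_↑ˡ d₂) (λ {i} {j} → ↑ˡ-injective d₂ i j) A#A′ (ℓ∈A , ℓ∈A′)
  ... | inj₁ ℓ∈A | inj₂ ℓ∈B′ = left#right (ℓ∈A , ℓ∈B′)
  ... | inj₂ ℓ∈B | inj₁ ℓ∈A′ = left#right (ℓ∈A′ , ℓ∈B)
  ... | inj₂ ℓ∈B | inj₂ ℓ∈B′ = map-disjoint (d₁ ↑ʳ_) (λ {i} {j} → ↑ʳ-injective d₁ i j) B#B′ (ℓ∈B , ℓ∈B′)

-- Frames of G and H combine into a frame of G □ H: an edge moving in the first
-- coordinate keeps its G-label (shifted left), one moving in the second keeps its
-- H-label (shifted right); spider legs go first along G, then along H.
module ProductFrame {G H : Graph} {d₁ d₂ s₁ s₂ : ℕ} (F₁ : Frame G d₁ s₁) (F₂ : Frame H d₂ s₂) where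
  open LabelSum d₁ d₂
  module F₁ = Frame F₁
  module F₂ = Frame F₂
  module C₁ = CutSystem F₁.cuts
  module C₂ = CutSystem F₂.cuts

  label : Edge (G □ H) → Fin (d₁ + d₂)
  label (u , v , inj₁ (_ , q)) = d₁ ↑ʳ C₂.label (proj₂ u , proj₂ v , q)
  label (u , v , inj₂ (_ , q)) = C₁.label (proj₁ u , proj₁ v , q) ↑ˡ d₂

  side : Fin (d₁ + d₂) → V (G □ H) → Bool
  side ℓ (a , b) = [ (λ i → C₁.side i a) , (λ j → C₂.side j b) ] (splitAt d₁ ℓ)

  crossing⇒label : ∀ e ℓ → side ℓ (src (G □ H) e) ≢ side ℓ (tgt (G □ H) e) → label e ≡ ℓ
  crossing⇒label ((u₁ , u₂) , (v₁ , v₂) , inj₁ (u₁≡v₁ , q)) ℓ differ with splitAt d₁ ℓ in split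
  ... | inj₁ i = ⊥-elim (differ (cong (C₁.side i) u₁≡v₁))
  ... | inj₂ j = trans (cong (d₁ ↑ʳ_) (C₂.crossing⇒label (u₂ , v₂ , q) j differ)) (splitAt⁻¹-↑ʳ split)
  crossing⇒label ((u₁ , u₂) , (v₁ , v₂) , inj₂ (u₂≡v₂ , q)) ℓ differ with splitAt d₁ ℓ in split
  ... | inj₂ j = ⊥-elim (differ (cong (C₂.side j) u₂≡v₂))
  ... | inj₁ i = trans (cong (_↑ˡ d₂) (C₁.crossing⇒label (u₁ , v₁ , q) i differ)) (splitAt⁻¹-↑ˡ split)

  label⇒crossing : ∀ e → side (label e) (src (G □ H) e) ≢ side (label e) (tgt (G □ H) e)
  label⇒crossing ((u₁ , u₂) , (v₁ , v₂) , inj₁ (_ , q))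
    rewrite splitAt-↑ʳ d₁ d₂ (C₂.label (u₂ , v₂ , q)) = C₂.label⇒crossing (u₂ , v₂ , q)
  label⇒crossing ((u₁ , u₂) , (v₁ , v₂) , inj₂ (_ , q))
    rewrite splitAt-↑ˡ d₁ (C₁.label (u₁ , v₁ , q)) d₂ = C₁.label⇒crossing (u₁ , v₁ , q)

  cuts : CutSystem (G □ H) (d₁ + d₂)
  cuts = record { label = label ; side = side ; crossing⇒label = crossing⇒label ; label⇒crossing = label⇒crossing }

  liftˡ : ∀ {a b} → Leg G a b → (c : V H) → Leg (G □ H) (a , c) (b , c)
  liftˡ [] c = []
  liftˡ (p ∷ l) c = inj₂ (refl , p) ∷ liftˡ l c

  liftʳ : (c : V G) → ∀ {a b} → Leg H a b → Leg (G □ H) (c , a) (c , b)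
  liftʳ c [] = []
  liftʳ c (p ∷ l) = inj₁ (refl , p) ∷ liftʳ c l

  labels-liftˡ : ∀ {a b} (l : Leg G a b) c →
    map label (legEdges (G □ H) (liftˡ l c)) ≡ map (_↑ˡ d₂) (map C₁.label (legEdges G l))
  labels-liftˡ [] c = refl
  labels-liftˡ (p ∷ l) c = cong (_ ∷_) (labels-liftˡ l c)

  labels-liftʳ : ∀ c {a b} (l : Leg H a b) →
    map label (legEdges (G □ H) (liftʳ c l)) ≡ map (d₁ ↑ʳ_) (map C₂.label (legEdges H l))
  labels-liftʳ c [] = refl
  labels-liftʳ c (p ∷ l) = cong (_ ∷_) (labels-liftʳ c l)

  productLeg : ∀ {a₁ a₂ b₁ b₂} → Leg G a₁ b₁ → Leg H a₂ b₂ → Leg (G □ H) (a₁ , a₂) (b₁ , b₂)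
  productLeg {a₂ = a₂} {b₁ = b₁} k l = _++ᴸ_ (G □ H) (liftˡ k a₂) (liftʳ b₁ l)

  labels-productLeg : ∀ {a₁ a₂ b₁ b₂} (k : Leg G a₁ b₁) (l : Leg H a₂ b₂) →
    map label (legEdges (G □ H) (productLeg k l))
      ≡ merge (map C₁.label (legEdges G k)) (map C₂.label (legEdges H l))
  labels-productLeg {a₂ = a₂} {b₁ = b₁} k l
    rewrite legEdges-++ (G □ H) (liftˡ k a₂) (liftʳ b₁ l)
          | map-++ label (legEdges (G □ H) (liftˡ k a₂)) (legEdges (G □ H) (liftʳ b₁ l))
          | labels-liftˡ k a₂ | labels-liftʳ b₁ l = refl

  spider : ∀ x y z → Spider (G □ H) label x y z
  spider (x₁ , x₂) (y₁ , y₂) (z₁ , z₂) = record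
    { centre = (S₁.centre , S₂.centre)
    ; leg-x = productLeg S₁.leg-x S₂.leg-x
    ; leg-y = productLeg S₁.leg-y S₂.leg-y
    ; leg-z = productLeg S₁.leg-z S₂.leg-z
    ; unique-x = subst Unique (sym lx) (merge-unique S₁.unique-x S₂.unique-x)
    ; unique-y = subst Unique (sym ly) (merge-unique S₁.unique-y S₂.unique-y)
    ; unique-z = subst Unique (sym lz) (merge-unique S₁.unique-z S₂.unique-z)
    ; disjoint-xy = subst₂ Disjoint (sym lx) (sym ly) (merge-disjoint S₁.disjoint-xy S₂.disjoint-xy)
    ; disjoint-xz = subst₂ Disjoint (sym lx) (sym lz) (merge-disjoint S₁.disjoint-xz S₂.disjoint-xz)
    ; disjoint-yz = subst₂ Disjoint (sym ly) (sym lz) (merge-disjoint S₁.disjoint-yz S₂.disjoint-yz) }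
    where
    module S₁ = Spider (F₁.spider x₁ y₁ z₁)
    module S₂ = Spider (F₂.spider x₂ y₂ z₂)
    lx = labels-productLeg S₁.leg-x S₂.leg-x
    ly = labels-productLeg S₁.leg-y S₂.leg-y
    lz = labels-productLeg S₁.leg-z S₂.leg-z

  trivial-factor : s₁ ≤ 1 → s₁ * s₂ ≤ s₂
  trivial-factor s₁≤1 = ≤-trans (*-monoˡ-≤ s₂ s₁≤1) (≤-reflexive (*-identityˡ s₂))

  lo≢hi : 2 ≤ s₁ * s₂ → (F₁.lo , F₂.lo) ≢ (F₁.hi , F₂.hi)
  lo≢hi 2≤s with 2 ≤? s₁
  ... | yes 2≤s₁ = λ lo≡hi → F₁.lo≢hi 2≤s₁ (cong proj₁ lo≡hi)
  ... | no 2≰s₁ = λ lo≡hi → F₂.lo≢hi (≤-trans 2≤s (trivial-factor (s≤s⁻¹ (≰⇒> 2≰s₁)))) (cong proj₂ lo≡hi)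

  -- A third vertex: inside G if s₁ ≥ 3, the corner (lo₁ , hi₂) if s₁ = 2 (then
  -- s₂ ≥ 2), and inside H if s₁ ≤ 1 (then s₂ ≥ 3).
  third : 3 ≤ s₁ * s₂ → Σ (V (G □ H)) λ z → z ≢ (F₁.lo , F₂.lo) × z ≢ (F₁.hi , F₂.hi)
  third 3≤s with 3 ≤? s₁ | 2 ≤? s₁
  ... | yes 3≤s₁ | _ =
    let z , z≢lo , z≢hi = F₁.third 3≤s₁
    in (z , F₂.lo) , (λ q → z≢lo (cong proj₁ q)) , (λ q → z≢hi (cong proj₁ q))
  ... | no 3≰s₁ | yes 2≤s₁ =
    (F₁.lo , F₂.hi) , (λ q → F₂.lo≢hi 2≤s₂ (sym (cong proj₂ q))) , (λ q → F₁.lo≢hi 2≤s₁ (cong proj₁ q))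
    where
    2≤s₂ : 2 ≤ s₂
    2≤s₂ with 2 ≤? s₂
    ... | yes 2≤s₂ = 2≤s₂
    ... | no 2≰s₂ with ≤-trans 3≤s (*-mono-≤ (s≤s⁻¹ (≰⇒> 3≰s₁)) (s≤s⁻¹ (≰⇒> 2≰s₂)))
    ...   | s≤s (s≤s ())
  ... | no _ | no 2≰s₁ =
    let z , z≢lo , z≢hi = F₂.third (≤-trans 3≤s (trivial-factor (s≤s⁻¹ (≰⇒> 2≰s₁))))
    in (F₁.lo , z) , (λ q → z≢lo (cong proj₂ q)) , (λ q → z≢hi (cong proj₂ q))

  frame : Frame (G □ H) (d₁ + d₂) (s₁ * s₂)
  frame = record
    { cuts = cuts
    ; lo = (F₁.lo , F₂.lo)
    ; hi = (F₁.hi , F₂.hi)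
    ; lo-side = lo-side
    ; hi-side = hi-side
    ; lo≢hi = lo≢hi
    ; third = third
    ; spider = spider }
    where
    lo-side : ∀ ℓ → side ℓ (F₁.lo , F₂.lo) ≡ false
    lo-side ℓ with splitAt d₁ ℓ
    ... | inj₁ i = F₁.lo-side i
    ... | inj₂ j = F₂.lo-side j
    hi-side : ∀ ℓ → side ℓ (F₁.hi , F₂.hi) ≡ true
    hi-side ℓ with splitAt d₁ ℓ
    ... | inj₁ i = F₁.hi-side i
    ... | inj₂ j = F₂.hi-side j

length≤sum : ∀ {k} (ns : Vec ℕ k) → VecAll.All (1 ≤_) ns → k ≤ sum ns
length≤sum [] VecAll.[] = z≤n
length≤sum (n ∷ ns) (1≤n VecAll.∷ 1≤ns) = +-mono-≤ 1≤n (length≤sum ns 1≤ns)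

productPathsFrame : ∀ {k} (ns : Vec ℕ (suc k)) → VecAll.All (1 ≤_) ns →
  Frame (ProdPaths ns) (sum ns ∸ suc k) (productV ns)
productPathsFrame (suc n ∷ []) (_ VecAll.∷ VecAll.[]) =
  subst₂ (Frame (Path (suc n))) (sym (+-identityʳ n)) (sym (*-identityʳ (suc n))) (PathFrame.frame n)
productPathsFrame {suc k} (suc n ∷ m ∷ ns) (_ VecAll.∷ 1≤ms) =
  subst (λ d → Frame (ProdPaths (suc n ∷ m ∷ ns)) d (productV (suc n ∷ m ∷ ns)))
    (sym (+-∸-assoc n (length≤sum (m ∷ ns) 1≤ms)))
    (ProductFrame.frame (PathFrame.frame n) (productPathsFrame (m ∷ ns) 1≤ms))

corollary1 : ∀ (k : ℕ) (ns : Vec ℕ k) → 1 ≤ k → VecAll.All (1 ≤_) ns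
    → 3 ≤ productV ns
    → Rx3≡ (ProdPaths ns) (sum ns ∸ k)
corollary1 zero [] () _ _
corollary1 (suc k) ns _ 1≤ns 3≤|V| = FrameTheory.frame⇒rx3 (ProdPaths ns) (productPathsFrame ns 1≤ns) 3≤|V|
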